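{- Let $q\ge1$ be an integer, let $(G_k)_{k\ge0}$ be defined by $G_0=\dots=G_{q-2}=0$, $G_{q-1}=1$, $G_{k+q}=G_{k+q-1}+G_k$ ($k\ge0$), and let $A=(a_k)_{k\ge0}$ with $a_k=G_{k+2q-2}$. Then for all $n\ge0$: $$G_{n+q}-1=\sum_{k=0}^{n}G_k,$$ $$G_{n+q-1}=\sum_{k=0}^{\lfloor n/q\rfloor}\binom{n-k(q-1)}{k},$$ $$S_A(G_{n+q-1})=\sum_{k=0}^{\lfloor n/q\rfloor}k\binom{n-k(q-1)}{k}.$$
   Context: For $q=1$, $G_k=2^k$. The sequence $A$ is strictly increasing with $a_0=1$. For such a sequence, the greedy algorithm represents each $m\ge1$ as $m=\sum_{i\ge0}d_i a_i$ with nonnegative integer digits $d_i$: if $a_i\le m<a_{i+1}$ it selects $a_i$ and repeats on $m-a_i$ until $0$ is reached. The sum-of-digits function is $s_A(m)=\sum_{i\ge0}d_i$ (with $s_A(0)=0$), and the cumulative sum-of-digits function is $S_A(m)=\sum_{j=0}^{m-1}s_A(j)$ (so $S_A(0)=0$). -}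

module Defs where

open import Data.Nat using (ℕ; zero; suc; _+_; _*_; _∸_; _≤ᵇ_; _<ᵇ_; _≡ᵇ_)
open import Data.Bool using (if_then_else_)
open import Data.List using (List; map; upTo)
open import Data.Nat.ListAction using (sum)

sumTo : ℕ → (ℕ → ℕ) → ℕ
sumTo N f = sum (map f (upTo (suc N)))

-- G_k for parameter q, via fuel (fuel k+1 suffices: recursive calls are on
-- indices k∸1, k∸q < k when k ≥ q ≥ 1).
-- G_0 = … = G_{q-2} = 0, G_{q-1} = 1, G_k = G_{k-1} + G_{k-q} for k ≥ q.
Gfuel : ℕ → ℕ → ℕ → ℕ
Gfuel zero     q k = 0
Gfuel (suc f)  q k =
  if k <ᵇ (q ∸ 1) then 0
  else if k ≡ᵇ (q ∸ 1) then 1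
  else Gfuel f q (k ∸ 1) + Gfuel f q (k ∸ q)

G : ℕ → ℕ → ℕ
G q k = Gfuel (suc k) q k

aSeq : ℕ → ℕ → ℕ
aSeq q k = G q (k + 2 * q ∸ 2)

-- greedy algorithm for a sequence a (strictly increasing, a 0 = 1):
-- largest index i ≤ start with a i ≤ m (searching downward)
largestIdx : (ℕ → ℕ) → ℕ → ℕ → ℕ
largestIdx a m zero    = zero
largestIdx a m (suc i) = if a (suc i) ≤ᵇ m then suc i else largestIdx a m i

-- number of greedy steps (= sum of digits); fuel m suffices since each
-- step subtracts some a_i ≥ 1.
digitSumFuel : (ℕ → ℕ) → ℕ → ℕ → ℕ
digitSumFuel a zero    m       = 0
digitSumFuel a (suc f) zero    = 0
digitSumFuel a (suc f) (suc m) =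
  suc (digitSumFuel a f (suc m ∸ a (largestIdx a (suc m) (suc m))))

sA : (ℕ → ℕ) → ℕ → ℕ
sA a m = digitSumFuel a m m

SA : (ℕ → ℕ) → ℕ → ℕ
SA a m = sum (map (sA a) (upTo m))

module Submission where

-- Write q = p + 1 and P n = G (n + p), so that P 0 = … = P p = 1 and
-- P (q + m) = P (p + m) + P m.  All three identities are proved by the
-- induction principle attached to this recurrence ('P-ind'): a property
-- that holds for n ≤ p and passes from p + m and m to q + m holds for all n.
--
--  * Part 1 (partial sums) is a telescoping induction on n.
--  * Part 2: the diagonal binomials B n k = (n - k p) C k obey Pascal's rule
--    in the form B (q + m) (k + 1) = B (p + m) (k + 1) + B m k, so any
--    long enough sum Σ_k B n k satisfies the recurrence of P.
--  * Part 3: since a m = P (p + m) and a (m + 1) = P (p + m) + P m, the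
--    greedy expansion of a number in [a m, a (m + 1)) is a m followed by the
--    expansion of the remainder ('SA-block', proved for any strictly
--    increasing sequence with a 0 = 1).  Hence S_A (P (q + m)) =
--    S_A (P (p + m)) + P m + S_A (P m), which is again the recurrence
--    satisfied by Σ_k k B n k, by Pascal's rule and Part 2.

open import Defs
open import Data.Nat using (ℕ; _+_; _*_; _∸_; _/_; NonZero)
open import Data.Nat.Combinatorics using (_C_)
open import Data.Product using (_×_)
open import Relation.Binary.PropositionalEquality using (_≡_)

open import Data.Nat using (zero; suc; _≤_; _<_; _≤?_; z≤n; s≤s; _<ᵇ_; _≡ᵇ_; _≤ᵇ_)
open import Data.Nat.Properties
open import Data.Nat.Combinatorics using (nCk+nC[k+1]≡[n+1]C[k+1])
open import Data.Nat.DivMod using (m≡m%n+[m/n]*n; m%n<n)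
open import Data.Nat.Induction using (<-rec)
open import Data.Nat.Tactic.RingSolver using (solve-∀)
open import Data.Nat.ListAction using (sum)
open import Data.Nat.ListAction.Properties using (sum-++)
open import Algebra.Properties.CommutativeSemigroup +-commutativeSemigroup using (interchange)
open import Data.Bool using (true; false; T)
open import Data.Unit using (tt)
open import Data.List using (map; upTo; [_]; _∷ʳ_; _++_)
open import Data.List.Properties using (upTo-∷ʳ; map-++)
open import Data.Product using (_,_)
open import Data.Sum using (inj₁; inj₂)
open import Data.Empty using (⊥-elim; ⊥-elim-irr)
open import Relation.Nullary using (yes; no)
open import Relation.Binary.PropositionalEquality
  using (refl; sym; trans; cong; cong₂; subst; subst₂; module ≡-Reasoning)
open ≡-Reasoning

Σ< : ℕ → (ℕ → ℕ) → ℕ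
Σ< zero    f = 0
Σ< (suc n) f = Σ< n f + f n

sum-upTo≡Σ< : ∀ n f → sum (map f (upTo n)) ≡ Σ< n f
sum-upTo≡Σ< zero    f = refl
sum-upTo≡Σ< (suc n) f = begin
  sum (map f (upTo (suc n)))       ≡⟨ cong (λ l → sum (map f l)) (sym (upTo-∷ʳ n)) ⟩
  sum (map f (upTo n ∷ʳ n))        ≡⟨ cong sum (map-++ f (upTo n) [ n ]) ⟩
  sum (map f (upTo n) ++ [ f n ])  ≡⟨ sum-++ (map f (upTo n)) [ f n ] ⟩
  sum (map f (upTo n)) + (f n + 0) ≡⟨ cong₂ _+_ (sum-upTo≡Σ< n f) (+-identityʳ (f n)) ⟩
  Σ< n f + f n                     ∎

Σ<-head : ∀ n f → Σ< (suc n) f ≡ f 0 + Σ< n (λ k → f (suc k))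
Σ<-head zero    f = +-comm 0 (f 0)
Σ<-head (suc n) f = trans (cong (_+ f (suc n)) (Σ<-head n f)) (+-assoc (f 0) _ _)

Σ<-split : ∀ x y f → Σ< (x + y) f ≡ Σ< x f + Σ< y (λ j → f (x + j))
Σ<-split x zero    f = trans (cong (λ z → Σ< z f) (+-identityʳ x)) (sym (+-identityʳ _))
Σ<-split x (suc y) f = begin
  Σ< (x + suc y) f                             ≡⟨ cong (λ z → Σ< z f) (+-suc x y) ⟩
  Σ< (x + y) f + f (x + y)                     ≡⟨ cong (_+ f (x + y)) (Σ<-split x y f) ⟩
  Σ< x f + Σ< y (λ j → f (x + j)) + f (x + y)  ≡⟨ +-assoc (Σ< x f) _ _ ⟩
  Σ< x f + Σ< (suc y) (λ j → f (x + j))        ∎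

Σ<-+ : ∀ n f g → Σ< n (λ k → f k + g k) ≡ Σ< n f + Σ< n g
Σ<-+ zero    f g = refl
Σ<-+ (suc n) f g =
  trans (cong (_+ (f n + g n)) (Σ<-+ n f g)) (interchange (Σ< n f) (Σ< n g) (f n) (g n))

Σ<-cong : ∀ n f g → (∀ k → k < n → f k ≡ g k) → Σ< n f ≡ Σ< n g
Σ<-cong zero    f g eq = refl
Σ<-cong (suc n) f g eq =
  cong₂ _+_ (Σ<-cong n f g (λ k k<n → eq k (m<n⇒m<1+n k<n))) (eq n ≤-refl)

Σ<-zero : ∀ n f → (∀ k → f k ≡ 0) → Σ< n f ≡ 0
Σ<-zero zero    f eq = refl
Σ<-zero (suc n) f eq = cong₂ _+_ (Σ<-zero n f eq) (eq n)

Σ<-suc : ∀ n f → Σ< n (λ k → suc (f k)) ≡ n + Σ< n f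
Σ<-suc zero    f = refl
Σ<-suc (suc n) f = begin
  Σ< n (λ k → suc (f k)) + suc (f n) ≡⟨ cong (_+ suc (f n)) (Σ<-suc n f) ⟩
  n + Σ< n f + suc (f n)             ≡⟨ +-suc (n + Σ< n f) (f n) ⟩
  suc (n + Σ< n f + f n)             ≡⟨ cong suc (+-assoc n _ _) ⟩
  suc n + (Σ< n f + f n)             ∎

-- The value of Gfuel does not depend on the fuel, as long as it exceeds the
-- index (the recursive calls are at strictly smaller indices).
Gfuel-irrelevant : ∀ p f f′ k → k < f → k < f′ → Gfuel f (suc p) k ≡ Gfuel f′ (suc p) k
Gfuel-irrelevant p (suc f) (suc f′) zero _ _ with p
... | zero  = refl
... | suc _ = refl
Gfuel-irrelevant p (suc f) (suc f′) (suc k) (s≤s k<f) (s≤s k<f′) with suc k <ᵇ p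
... | true  = refl
... | false with suc k ≡ᵇ p
...   | true  = refl
...   | false = cong₂ _+_ (Gfuel-irrelevant p f f′ k k<f k<f′)
                          (Gfuel-irrelevant p f f′ (k ∸ p)
                             (≤-<-trans (m∸n≤m k p) k<f) (≤-<-trans (m∸n≤m k p) k<f′))

-- Throughout, q = p + 1 and p = q - 1 is the index of the first 1 in G.
module Sequence (p : ℕ) where

  q : ℕ
  q = suc p

  G-below : ∀ k → k < p → G q k ≡ 0
  G-below k k<p with k <ᵇ p in eq
  ... | true  = refl
  ... | false = ⊥-elim (subst T eq (<⇒<ᵇ k<p))

  G-at : G q p ≡ 1
  G-at with p <ᵇ p in lt | p ≡ᵇ p in eq
  ... | true  | _     = ⊥-elim (<-irrefl refl (<ᵇ⇒< p p (subst T (sym lt) tt)))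
  ... | false | true  = refl
  ... | false | false = ⊥-elim (subst T eq (≡⇒≡ᵇ p p refl))

  G-rec : ∀ m → G q (q + m) ≡ G q (p + m) + G q m
  G-rec m with q + m <ᵇ p in lt | q + m ≡ᵇ p in eq
  ... | true  | _     = ⊥-elim (<-asym (s≤s (m≤m+n p m)) (<ᵇ⇒< (q + m) p (subst T (sym lt) tt)))
  ... | false | true  = ⊥-elim (<-irrefl (sym (≡ᵇ⇒≡ (q + m) p (subst T (sym eq) tt))) (s≤s (m≤m+n p m)))
  ... | false | false = begin
    Gfuel (q + m) q (p + m) + Gfuel (q + m) q (q + m ∸ q)
      ≡⟨ cong (λ z → Gfuel (q + m) q (p + m) + Gfuel (q + m) q z) (m+n∸m≡n q m) ⟩
    Gfuel (q + m) q (p + m) + Gfuel (q + m) q m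
      ≡⟨ cong (G q (p + m) +_) (Gfuel-irrelevant p (q + m) (suc m) m (s≤s (m≤n+m m p)) ≤-refl) ⟩
    G q (p + m) + G q m ∎

  G-partial-sums : ∀ n → G q (n + q) ≡ suc (Σ< (suc n) (G q))
  G-partial-sums zero = begin
    G q (0 + q)         ≡⟨ cong (G q) (+-comm 0 q) ⟩
    G q (q + 0)         ≡⟨ G-rec 0 ⟩
    G q (p + 0) + G q 0 ≡⟨ cong (λ z → G q z + G q 0) (+-identityʳ p) ⟩
    G q p + G q 0       ≡⟨ cong (_+ G q 0) G-at ⟩
    suc (G q 0)         ∎
  G-partial-sums (suc n) = begin
    G q (suc n + q)               ≡⟨ cong (G q) (+-comm (suc n) q) ⟩
    G q (q + suc n)               ≡⟨ G-rec (suc n) ⟩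
    G q (p + suc n) + G q (suc n) ≡⟨ cong (λ z → G q z + G q (suc n)) (trans (+-comm p (suc n)) (sym (+-suc n p))) ⟩
    G q (n + q) + G q (suc n)     ≡⟨ cong (_+ G q (suc n)) (G-partial-sums n) ⟩
    suc (Σ< (suc n) (G q) + G q (suc n)) ∎

  P : ℕ → ℕ
  P n = G q (n + p)

  P-initial : ∀ n → n ≤ p → P n ≡ 1
  P-initial zero    _    = G-at
  P-initial (suc n) n<p = begin
    G q (suc n + p)     ≡⟨ cong (λ z → G q (suc z)) (+-comm n p) ⟩
    G q (q + n)         ≡⟨ G-rec n ⟩
    G q (p + n) + G q n ≡⟨ cong₂ _+_ (cong (G q) (+-comm p n)) (G-below n n<p) ⟩
    P n + 0             ≡⟨ +-identityʳ (P n) ⟩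
    P n                 ≡⟨ P-initial n (<⇒≤ n<p) ⟩
    1                   ∎

  P-rec : ∀ m → P (q + m) ≡ P (p + m) + P m
  P-rec m = begin
    G q (q + m + p)                 ≡⟨ cong (G q) (+-assoc q m p) ⟩
    G q (q + (m + p))               ≡⟨ G-rec (m + p) ⟩
    G q (p + (m + p)) + G q (m + p) ≡⟨ cong (λ z → G q z + P m) (sym (+-assoc p m p)) ⟩
    P (p + m) + P m                 ∎

  P-ind : (Q : ℕ → Set) → (∀ n → n ≤ p → Q n) →
          (∀ m → Q (p + m) → Q m → Q (q + m)) → ∀ n → Q n
  P-ind Q base step = <-rec Q ind
    where
    ind : ∀ n → (∀ {m} → m < n → Q m) → Q n
    ind n ih with n ≤? p
    ... | yes n≤p = base n n≤p
    ... | no  n≰p with m≤n⇒∃[o]m+o≡n (≰⇒> n≰p)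
    ...   | m , refl = step m (ih ≤-refl) (ih (s≤s (m≤n+m m p)))

  P-positive : ∀ n → 1 ≤ P n
  P-positive = P-ind (λ n → 1 ≤ P n) (λ n n≤p → ≤-reflexive (sym (P-initial n n≤p)))
    (λ m 1≤P[p+m] _ → subst (1 ≤_) (sym (P-rec m)) (≤-trans 1≤P[p+m] (m≤m+n _ _)))

module Greedy (a : ℕ → ℕ) (a0≡1 : a 0 ≡ 1) (a-inc : ∀ k → a k < a (suc k)) where

  a-mono : ∀ {i j} → i ≤ j → a i ≤ a j
  a-mono {i} {zero}  z≤n  = ≤-refl
  a-mono {i} {suc j} i≤j+1 with m≤n⇒m<n∨m≡n i≤j+1
  ... | inj₁ (s≤s i≤j) = ≤-trans (a-mono i≤j) (<⇒≤ (a-inc j))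
  ... | inj₂ refl      = ≤-refl

  a-positive : ∀ k → 1 ≤ a k
  a-positive k = subst (_≤ a k) a0≡1 (a-mono z≤n)

  index<a : ∀ k → k < a k
  index<a zero    = a-positive 0
  index<a (suc k) = ≤-<-trans (index<a k) (a-inc k)

  largestIdx-block : ∀ s k m → k ≤ s → a k ≤ m → m < a (suc k) → largestIdx a m s ≡ k
  largestIdx-block zero .zero m z≤n _ _ = refl
  largestIdx-block (suc s) k m k≤s+1 ak≤m m<ak+1 with a (suc s) ≤ᵇ m in eq | m≤n⇒m<n∨m≡n k≤s+1
  ... | true  | inj₂ refl       = refl
  ... | true  | inj₁ (s≤s k≤s) = ⊥-elim (<-irrefl refl (<-≤-trans m<ak+1
        (≤-trans (a-mono (s≤s k≤s)) (≤ᵇ⇒≤ (a (suc s)) m (subst T (sym eq) tt)))))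
  ... | false | inj₂ refl       = ⊥-elim (subst T eq (≤⇒≤ᵇ ak≤m))
  ... | false | inj₁ (s≤s k≤s) = largestIdx-block s k m k≤s ak≤m m<ak+1

  -- Any fuel f ≥ x suffices to compute the digit sum of x (every greedy step
  -- removes at least 1).
  digitSumFuel-irrelevant : ∀ f f′ x → x ≤ f → x ≤ f′ → digitSumFuel a f x ≡ digitSumFuel a f′ x
  digitSumFuel-irrelevant zero    zero     zero _ _ = refl
  digitSumFuel-irrelevant zero    (suc f′) zero _ _ = refl
  digitSumFuel-irrelevant (suc f) zero     zero _ _ = refl
  digitSumFuel-irrelevant (suc f) (suc f′) zero _ _ = refl
  digitSumFuel-irrelevant (suc f) (suc f′) (suc x) (s≤s x≤f) (s≤s x≤f′) =
    cong suc (digitSumFuel-irrelevant f f′ y (≤-trans y≤x x≤f) (≤-trans y≤x x≤f′))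
    where
    y : ℕ
    y = suc x ∸ a (largestIdx a (suc x) (suc x))
    y≤x : y ≤ x
    y≤x = ∸-monoʳ-≤ (suc x) (a-positive (largestIdx a (suc x) (suc x)))

  sA-step : ∀ k x → a k ≤ x → x < a (suc k) → sA a x ≡ suc (sA a (x ∸ a k))
  sA-step k zero    ak≤0 _ = ⊥-elim (<-irrefl refl (<-≤-trans (a-positive k) ak≤0))
  sA-step k (suc y) ak≤x x<ak+1
    rewrite largestIdx-block (suc y) k (suc y) (<⇒≤ (<-≤-trans (index<a k) ak≤x)) ak≤x x<ak+1 =
    cong suc (digitSumFuel-irrelevant y (suc y ∸ a k) (suc y ∸ a k)
                (∸-monoʳ-≤ (suc y) (a-positive k)) ≤-refl)

  SA-block : ∀ k Y → a k + Y ≤ a (suc k) → SA a (a k + Y) ≡ SA a (a k) + (Y + SA a Y)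
  SA-block k Y bound = begin
    SA a (a k + Y)                         ≡⟨ sum-upTo≡Σ< (a k + Y) (sA a) ⟩
    Σ< (a k + Y) (sA a)                    ≡⟨ Σ<-split (a k) Y (sA a) ⟩
    Σ< (a k) (sA a) + Σ< Y (λ j → sA a (a k + j))
      ≡⟨ cong₂ _+_ (sym (sum-upTo≡Σ< (a k) (sA a))) (Σ<-cong Y _ _ shifted) ⟩
    SA a (a k) + Σ< Y (λ j → suc (sA a j)) ≡⟨ cong (SA a (a k) +_) (Σ<-suc Y (sA a)) ⟩
    SA a (a k) + (Y + Σ< Y (sA a))         ≡⟨ cong (λ z → SA a (a k) + (Y + z)) (sym (sum-upTo≡Σ< Y (sA a))) ⟩
    SA a (a k) + (Y + SA a Y)              ∎
    where
    shifted : ∀ j → j < Y → sA a (a k + j) ≡ suc (sA a j)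
    shifted j j<Y = trans (sA-step k (a k + j) (m≤m+n (a k) j) (<-≤-trans (+-monoʳ-< (a k) j<Y) bound))
                          (cong (λ z → suc (sA a z)) (m+n∸m≡n (a k) j))

-- Pascal's rule for n = m - k p: (m + 1 - k p) C (k + 1) equals
-- (m - k p) C (k + 1) + (m - k p) C k.  When k p > m both sides vanish
-- (then k ≥ 1, since 0 · p ≤ m).
diagonal-pascal : ∀ p m k → (suc m ∸ k * p) C suc k ≡ (m ∸ k * p) C suc k + (m ∸ k * p) C k
diagonal-pascal p m k with k * p ≤? m
... | yes kp≤m = begin
  (suc m ∸ k * p) C suc k ≡⟨ cong (_C suc k) (+-∸-assoc 1 kp≤m) ⟩
  suc d C suc k           ≡⟨ sym (nCk+nC[k+1]≡[n+1]C[k+1] d k) ⟩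
  d C k + d C suc k       ≡⟨ +-comm (d C k) (d C suc k) ⟩
  d C suc k + d C k       ∎
  where
  d : ℕ
  d = m ∸ k * p
diagonal-pascal p m zero    | no 0≰m = ⊥-elim (0≰m z≤n)
diagonal-pascal p m (suc j) | no kp≰m
  rewrite m≤n⇒m∸n≡0 (≰⇒> kp≰m) | m≤n⇒m∸n≡0 (<⇒≤ (≰⇒> kp≰m)) = refl

module Binomials (p : ℕ) where
  open Sequence p

  B : ℕ → ℕ → ℕ
  B n k = (n ∸ k * p) C k

  B-pascal : ∀ m k → B (q + m) (suc k) ≡ B (p + m) (suc k) + B m k
  B-pascal m k = begin
    (q + m ∸ (p + k * p)) C suc k    ≡⟨ cong (λ z → (z ∸ (p + k * p)) C suc k) (sym (+-suc p m)) ⟩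
    (p + suc m ∸ (p + k * p)) C suc k ≡⟨ cong (_C suc k) ([m+n]∸[m+o]≡n∸o p (suc m) (k * p)) ⟩
    (suc m ∸ k * p) C suc k           ≡⟨ diagonal-pascal p m k ⟩
    d C suc k + d C k                 ≡⟨ cong (λ z → z C suc k + d C k) (sym ([m+n]∸[m+o]≡n∸o p m (k * p))) ⟩
    (p + m ∸ (p + k * p)) C suc k + d C k ∎
    where
    d : ℕ
    d = m ∸ k * p

  B-initial : ∀ n k → n ≤ p → B n (suc k) ≡ 0
  B-initial n k n≤p = cong (_C suc k) (m≤n⇒m∸n≡0 (≤-trans n≤p (m≤m+n p (k * p))))

  -- Part 2: P n = Σ_k B n k, for any number M of terms with M q > n (the
  -- terms with k > n / q vanish).
  Σ<-B≡P : ∀ n M → n < M * q → Σ< M (B n) ≡ P n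
  Σ<-B≡P = P-ind (λ n → ∀ M → n < M * q → Σ< M (B n) ≡ P n) base step
    where
    base : ∀ n → n ≤ p → ∀ M → n < M * q → Σ< M (B n) ≡ P n
    base n n≤p (suc M) _ = begin
      Σ< (suc M) (B n)                ≡⟨ Σ<-head M (B n) ⟩
      1 + Σ< M (λ k → B n (suc k))    ≡⟨ cong suc (Σ<-zero M _ (λ k → B-initial n k n≤p)) ⟩
      1                               ≡⟨ sym (P-initial n n≤p) ⟩
      P n                             ∎
    step : ∀ m → (∀ M → p + m < M * q → Σ< M (B (p + m)) ≡ P (p + m))
               → (∀ M → m < M * q → Σ< M (B m) ≡ P m)
               → ∀ M → q + m < M * q → Σ< M (B (q + m)) ≡ P (q + m)
    step m ih-p+m ih-m (suc M) bound = begin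
      Σ< (suc M) (B (q + m))                               ≡⟨ Σ<-head M (B (q + m)) ⟩
      1 + Σ< M (λ k → B (q + m) (suc k))                   ≡⟨ cong suc (Σ<-cong M _ _ (λ k _ → B-pascal m k)) ⟩
      1 + Σ< M (λ k → B (p + m) (suc k) + B m k)           ≡⟨ cong suc (Σ<-+ M _ _) ⟩
      1 + (Σ< M (λ k → B (p + m) (suc k)) + Σ< M (B m))    ≡⟨ cong (_+ Σ< M (B m)) (sym (Σ<-head M (B (p + m)))) ⟩
      Σ< (suc M) (B (p + m)) + Σ< M (B m)
        ≡⟨ cong₂ _+_ (ih-p+m (suc M) (<-trans (n<1+n (p + m)) bound)) (ih-m M (+-cancelˡ-< q m (M * q) bound)) ⟩
      P (p + m) + P m                                      ≡⟨ sym (P-rec m) ⟩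
      P (q + m)                                            ∎

module DigitSums (p : ℕ) where
  open Sequence p
  open Binomials p

  a : ℕ → ℕ
  a = aSeq q

  a≡P : ∀ k → a k ≡ P (p + k)
  a≡P k = cong (G q) (begin
    k + 2 * q ∸ 2           ≡⟨ cong (_∸ 2) (index k p) ⟩
    2 + (p + k + p) ∸ 2     ≡⟨ m+n∸m≡n 2 (p + k + p) ⟩
    p + k + p               ∎)
    where
    index : ∀ k p → k + 2 * suc p ≡ 2 + (p + k + p)
    index = solve-∀

  a-suc : ∀ k → a (suc k) ≡ P (p + k) + P k
  a-suc k = trans (a≡P (suc k)) (trans (cong P (+-suc p k)) (P-rec k))

  a0≡1 : a 0 ≡ 1
  a0≡1 = trans (a≡P 0) (P-initial (p + 0) (≤-reflexive (+-identityʳ p)))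

  a-inc : ∀ k → a k < a (suc k)
  a-inc k = subst₂ _<_ (sym (a≡P k)) (sym (a-suc k))
    (subst (_< P (p + k) + P k) (+-identityʳ _) (+-monoʳ-< (P (p + k)) (P-positive k)))

  open Greedy a a0≡1 a-inc

  SA-P-rec : ∀ m → SA a (P (q + m)) ≡ SA a (P (p + m)) + (P m + SA a (P m))
  SA-P-rec m = begin
    SA a (P (q + m))             ≡⟨ cong (SA a) (trans (P-rec m) (cong (_+ P m) (sym (a≡P m)))) ⟩
    SA a (a m + P m)             ≡⟨ SA-block m (P m) (≤-reflexive (trans (cong (_+ P m) (a≡P m)) (sym (a-suc m)))) ⟩
    SA a (a m) + (P m + SA a (P m)) ≡⟨ cong (λ z → SA a z + (P m + SA a (P m))) (a≡P m) ⟩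
    SA a (P (p + m)) + (P m + SA a (P m)) ∎

  Σ<-kB≡SA : ∀ n M → n < M * q → Σ< M (λ k → k * B n k) ≡ SA a (P n)
  Σ<-kB≡SA = P-ind (λ n → ∀ M → n < M * q → Σ< M (λ k → k * B n k) ≡ SA a (P n)) base step
    where
    base : ∀ n → n ≤ p → ∀ M → n < M * q → Σ< M (λ k → k * B n k) ≡ SA a (P n)
    base n n≤p (suc M) _ = begin
      Σ< (suc M) (λ k → k * B n k)           ≡⟨ Σ<-head M (λ k → k * B n k) ⟩
      Σ< M (λ k → suc k * B n (suc k))
        ≡⟨ Σ<-zero M _ (λ k → trans (cong (suc k *_) (B-initial n k n≤p)) (*-zeroʳ (suc k))) ⟩
      0                                      ≡⟨ cong (SA a) (sym (P-initial n n≤p)) ⟩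
      SA a (P n)                             ∎
    step : ∀ m → (∀ M → p + m < M * q → Σ< M (λ k → k * B (p + m) k) ≡ SA a (P (p + m)))
               → (∀ M → m < M * q → Σ< M (λ k → k * B m k) ≡ SA a (P m))
               → ∀ M → q + m < M * q → Σ< M (λ k → k * B (q + m) k) ≡ SA a (P (q + m))
    step m ih-p+m ih-m (suc M) bound = begin
      Σ< (suc M) (λ k → k * B (q + m) k)                  ≡⟨ Σ<-head M (λ k → k * B (q + m) k) ⟩
      Σ< M (λ k → suc k * B (q + m) (suc k))              ≡⟨ Σ<-cong M _ _ (λ k _ → weighted-pascal k) ⟩
      Σ< M (λ k → suc k * B (p + m) (suc k) + (B m k + k * B m k)) ≡⟨ Σ<-+ M _ _ ⟩
      Σ< M (λ k → suc k * B (p + m) (suc k)) + Σ< M (λ k → B m k + k * B m k)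
        ≡⟨ cong₂ _+_ (sym (Σ<-head M (λ k → k * B (p + m) k))) (Σ<-+ M _ _) ⟩
      Σ< (suc M) (λ k → k * B (p + m) k) + (Σ< M (B m) + Σ< M (λ k → k * B m k))
        ≡⟨ cong₂ _+_ (ih-p+m (suc M) (<-trans (n<1+n (p + m)) bound))
                     (cong₂ _+_ (Σ<-B≡P m M m<Mq) (ih-m M m<Mq)) ⟩
      SA a (P (p + m)) + (P m + SA a (P m))               ≡⟨ sym (SA-P-rec m) ⟩
      SA a (P (q + m))                                    ∎
      where
      m<Mq : m < M * q
      m<Mq = +-cancelˡ-< q m (M * q) bound
      -- Pascal's rule, weighted by k + 1 (using (k + 1) B m k = B m k + k B m k).
      weighted-pascal : ∀ k → suc k * B (q + m) (suc k) ≡ suc k * B (p + m) (suc k) + (B m k + k * B m k)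
      weighted-pascal k = trans (cong (suc k *_) (B-pascal m k))
                                (*-distribˡ-+ (suc k) (B (p + m) (suc k)) (B m k))

n<[1+n/q]*q : ∀ p n → n < suc (n / suc p) * suc p
n<[1+n/q]*q p n = subst (_< suc (n / suc p) * suc p) (sym (m≡m%n+[m/n]*n n (suc p)))
  (+-monoˡ-< ((n / suc p) * suc p) (m%n<n n (suc p)))

theorem4 : (q : ℕ) → .{{_ : NonZero q}} → (n : ℕ) →
    (G q (n + q) ∸ 1 ≡ sumTo n (λ k → G q k))
    × (G q (n + q ∸ 1) ≡ sumTo (n / q) (λ k → (n ∸ k * (q ∸ 1)) C k))
    × (SA (aSeq q) (G q (n + q ∸ 1)) ≡ sumTo (n / q) (λ k → k * ((n ∸ k * (q ∸ 1)) C k)))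
theorem4 zero {{nonZero}} n = ⊥-elim-irr (NonZero.nonZero nonZero)
theorem4 (suc p) n = part1 , part2 , part3
  where
  open Sequence p
  open Binomials p
  open DigitSums p
  n+q∸1≡n+p : n + q ∸ 1 ≡ n + p
  n+q∸1≡n+p = cong (_∸ 1) (+-suc n p)
  M : ℕ
  M = suc (n / q)
  part1 : G q (n + q) ∸ 1 ≡ sumTo n (G q)
  part1 = trans (cong (_∸ 1) (G-partial-sums n)) (sym (sum-upTo≡Σ< (suc n) (G q)))
  part2 : G q (n + q ∸ 1) ≡ sumTo (n / q) (B n)
  part2 = trans (cong (G q) n+q∸1≡n+p)
                (sym (trans (sum-upTo≡Σ< M (B n)) (Σ<-B≡P n M (n<[1+n/q]*q p n))))
  part3 : SA a (G q (n + q ∸ 1)) ≡ sumTo (n / q) (λ k → k * B n k)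
  part3 = trans (cong (λ i → SA a (G q i)) n+q∸1≡n+p)
                (sym (trans (sum-upTo≡Σ< M (λ k → k * B n k)) (Σ<-kB≡SA n M (n<[1+n/q]*q p n))))
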